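{- Let $d \ge 1$ and $S \subseteq \{0,1\}^d$. Consider the flow network consisting of the directed $d$-dimensional hypercube in which every hypercube edge has capacity $1$, together with a source supernode with an infinite-capacity edge to each vertex of $S$ and a sink supernode with an infinite-capacity edge from each vertex of $\overline{S} = \{0,1\}^d \setminus S$. Then the maximum flow from the source supernode to the sink supernode is at least $\mathrm{vol}^+(S)$, the directed volume of $S$.
   Context: The directed $d$-dimensional hypercube has vertex set $\{0,1\}^d$ and a directed edge $(x,y)$ whenever $x$ and $y$ differ in exactly one coordinate and $y$ has one more $1$ than $x$. Write $x \prec y$ if $x \ne y$ and $x_i \le y_i$ for all $i$. A matched pair $(S',T';\phi)$ consists of sets $S',T' \subseteq \{0,1\}^d$ and a bijection $\phi: S' \to T'$ with $s \prec \phi(s)$ for all $s \in S'$. The directed volume of $S$ is $\mathrm{vol}^+(S) = \max\{|S'| : S' \subseteq S,\ T' \subseteq \overline{S},\ \exists \phi \text{ such that } (S',T';\phi) \text{ is a matched pair}\}$. -}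

module Defs where

open import Data.Bool using (Bool; true; false; not; if_then_else_) renaming (_≤_ to _≤ᵇ_)
open import Data.Nat using (ℕ; zero; suc; _+_; _≤_)
open import Data.Fin using (Fin)
open import Data.Vec using (Vec; []; _∷_; lookup; _[_]≔_)
open import Data.List using (List; []; _∷_; map; length; allFin; _++_)
open import Data.Nat.ListAction using (sum)
open import Data.List.Relation.Unary.Unique.Propositional using (Unique)
open import Data.List.Relation.Unary.All using (All)
open import Data.Product using (_×_; _,_; proj₁; proj₂)
open import Relation.Binary.PropositionalEquality using (_≡_)
open import Relation.Nullary using (¬_)

-- Vertices of the d-dimensional hypercube {0,1}^d (false = 0, true = 1).
Vertex : ℕ → Set
Vertex d = Vec Bool d

allVertices : (d : ℕ) → List (Vertex d)
allVertices zero    = [] ∷ []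
allVertices (suc d) = map (false ∷_) (allVertices d) ++ map (true ∷_) (allVertices d)

VSubset : ℕ → Set
VSubset d = Vertex d → Bool

flip : ∀ {d} → Vertex d → Fin d → Vertex d
flip x i = x [ i ]≔ not (lookup x i)

_≺_ : ∀ {d} → Vertex d → Vertex d → Set
x ≺ y = ¬ (x ≡ y) × (∀ i → lookup x i ≤ᵇ lookup y i)

-- A matched pair (S',T';φ) with S' ⊆ S and T' ⊆ complement of S, given as the
-- graph of φ: a list of pairs (s , φ s). Distinct first components = S',
-- distinct second components = T' (so φ is a bijection S' → T'), |S'| = length.
record MatchedPairIn {d : ℕ} (S : VSubset d) : Set where
  field
    pairs      : List (Vertex d × Vertex d)
    srcUnique  : Unique (map proj₁ pairs)
    tgtUnique  : Unique (map proj₂ pairs)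
    srcInS     : All (λ p → S (proj₁ p) ≡ true) pairs
    tgtNotInS  : All (λ p → S (proj₂ p) ≡ false) pairs
    below      : All (λ p → proj₁ p ≺ proj₂ p) pairs

  size : ℕ
  size = length pairs

sumFin : ∀ {d} → (Fin d → ℕ) → ℕ
sumFin {d} g = sum (map g (allFin d))

-- A flow in the network: directed hypercube (edge x → flip x i when x_i = 0,
-- capacity 1), source supernode with infinite-capacity edges to each s ∈ S,
-- sink supernode with infinite-capacity edges from each t ∉ S.
record Flow {d : ℕ} (S : VSubset d) : Set where
  field
    -- hyp x i : flow on the hypercube edge x → flip x i (exists only if x_i = 0)
    hyp      : Vertex d → Fin d → ℕ
    -- src x : flow on source → x ; snk x : flow on x → sink
    src      : Vertex d → ℕ
    snk      : Vertex d → ℕ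
    capacity : ∀ x i → hyp x i ≤ 1
    noEdge   : ∀ x i → lookup x i ≡ true → hyp x i ≡ 0
    srcOnlyS : ∀ x → S x ≡ false → src x ≡ 0
    snkOnlyS̄ : ∀ x → S x ≡ true → snk x ≡ 0

  inflow : Vertex d → ℕ
  inflow x = src x + sumFin (λ i → if lookup x i then hyp (flip x i) i else 0)

  outflow : Vertex d → ℕ
  outflow x = snk x + sumFin (λ i → if lookup x i then 0 else hyp x i)

  field
    conservation : ∀ x → inflow x ≡ outflow x

  value : ℕ
  value = sum (map src (allVertices d))

-- Sending one unit along every hypercube edge that leaves S gives a flow whose value is
-- the number |∂⁺S| of such edges, so it suffices to show vol⁺(S) ≤ |∂⁺S|.
--
-- Let U be up-closed. A matched pair s ≺ φ(s) has s ∈ S ∖ U, or else φ(s) ∈ U ∖ S; this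
-- witness in S △ U determines the pair, so vol⁺(S) ≤ |S △ U|. An up-closed U with
-- |S △ U| ≤ |∂⁺S| is built by induction on d. Split S along the first coordinate into
-- S₀ and S₁, and take up-closed U₀, U₁ for them. The set that is U₀ ∩ U₁ on the slice
-- x₁ = 0 and U₁ on x₁ = 1 is up-closed, and so is the one that is U₀ and U₀ ∪ U₁.
-- A pointwise exchange inequality shows that their distances to S add up to at most
-- twice |S₀ △ U₀| + |S₁ △ U₁| + |S₀ ∖ S₁|, and |∂⁺S| = |∂⁺S₀| + |∂⁺S₁| + |S₀ ∖ S₁|,
-- since the edges in direction 1 leaving S are exactly the ones out of S₀ ∖ S₁.
module Submission where

open import Defs
open import Data.Nat using (ℕ; _≤_)
open import Data.Product using (Σ)

open import Algebra.Properties.CommutativeSemigroup using (interchange)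
open import Data.Bool using (Bool; true; false; not; if_then_else_; _∧_; _∨_; _xor_; b≤b; f≤t)
  renaming (_≤_ to _≤ᵇ_)
open import Data.Bool.Properties using (_≟_; ∧-zeroʳ; ∨-zeroʳ; ∧-conicalˡ; ∧-conicalʳ; xor-same)
open import Data.Empty using (⊥-elim)
open import Data.Fin using (Fin; zero; suc)
open import Data.List using (List; []; _∷_; map; length; _++_; allFin)
open import Data.List.Properties using (length-map; map-++; map-∘; map-cong; map-tabulate)
open import Data.List.Relation.Unary.All as All using (All; []; _∷_)
import Data.List.Relation.Unary.All.Properties as All
open import Data.List.Relation.Unary.AllPairs as AllPairs using (AllPairs; []; _∷_)
import Data.List.Relation.Unary.AllPairs.Properties as AllPairs
open import Data.List.Relation.Unary.Unique.Propositional using (Unique)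
open import Data.Nat using (zero; suc; _+_; _≤?_; z≤n)
open import Data.Nat.ListAction using (sum)
open import Data.Nat.ListAction.Properties using (sum-++)
open import Data.Nat.Properties
  using (≤-refl; ≤-reflexive; ≤-trans; +-comm; +-suc; +-mono-≤; +-monoˡ-≤; +-monoʳ-≤; +-cancelˡ-≤; m≤m+n;
         ≰⇒≥; ≤ᵇ⇒≤; +-commutativeSemigroup; module ≤-Reasoning)
open import Data.Nat.Tactic.RingSolver using (solve-∀)
open import Data.Product using (_×_; _,_; proj₁; proj₂)
open import Data.Sum using (_⊎_; inj₁; inj₂)
open import Data.Unit using (tt)
open import Data.Vec using ([]; _∷_; lookup)
open import Data.Vec.Relation.Binary.Pointwise.Extensional using (ext; extensional⇒inductive)
open import Data.Vec.Relation.Binary.Pointwise.Inductive using (Pointwise; []; _∷_)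
open import Function using (_∘_; id)
open import Relation.Binary.PropositionalEquality
open import Relation.Nullary using (yes; no)

indicator : Bool → ℕ
indicator b = if b then 1 else 0

indicator≤1 : ∀ b → indicator b ≤ 1
indicator≤1 true  = ≤-refl
indicator≤1 false = z≤n

if-then-0 : ∀ b {n} → n ≡ 0 → (if b then n else 0) ≡ 0
if-then-0 true  n≡0 = n≡0
if-then-0 false _   = refl

if-then-0-else : ∀ b {n} → (b ≡ true → n ≡ 0) → (if b then 0 else n) ≡ n
if-then-0-else true  n≡0 = sym (n≡0 refl)
if-then-0-else false _   = refl

m+n≤o+o⇒m≤o⊎n≤o : ∀ {m n o} → m + n ≤ o + o → m ≤ o ⊎ n ≤ o
m+n≤o+o⇒m≤o⊎n≤o {m} {n} {o} m+n≤o+o with m ≤? o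
... | yes m≤o = inj₁ m≤o
... | no  m≰o = inj₂ (+-cancelˡ-≤ o n o (≤-trans (+-monoˡ-≤ n (≰⇒≥ m≰o)) m+n≤o+o))

module _ {A : Set} where

  sum-map-+ : ∀ (f g : A → ℕ) xs → sum (map (λ x → f x + g x) xs) ≡ sum (map f xs) + sum (map g xs)
  sum-map-+ f g []       = refl
  sum-map-+ f g (x ∷ xs) =
    trans (cong (f x + g x +_) (sum-map-+ f g xs)) (interchange +-commutativeSemigroup (f x) (g x) _ _)

  sum-map-mono : ∀ {f g : A → ℕ} → (∀ x → f x ≤ g x) → ∀ xs → sum (map f xs) ≤ sum (map g xs)
  sum-map-mono f≤g []       = z≤n
  sum-map-mono f≤g (x ∷ xs) = +-mono-≤ (f≤g x) (sum-map-mono f≤g xs)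

  sum-map-zero : ∀ {f : A → ℕ} → (∀ x → f x ≡ 0) → ∀ xs → sum (map f xs) ≡ 0
  sum-map-zero f≡0 []       = refl
  sum-map-zero f≡0 (x ∷ xs) = cong₂ _+_ (f≡0 x) (sum-map-zero f≡0 xs)

  AllPairs-mapWithAll : ∀ {P : A → Set} {R Q : A → A → Set} →
    (∀ {x y} → P x → P y → R x y → Q x y) → ∀ {xs} → All P xs → AllPairs R xs → AllPairs Q xs
  AllPairs-mapWithAll f []         []         = []
  AllPairs-mapWithAll f (px ∷ pxs) (rx ∷ rxs) =
    All.zipWith (λ (py , r) → f px py r) (pxs , rx) ∷ AllPairs-mapWithAll f pxs rxs

sumFin-cong : ∀ {d} {f g : Fin d → ℕ} → (∀ i → f i ≡ g i) → sumFin f ≡ sumFin g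
sumFin-cong {d} f≡g = cong sum (map-cong f≡g (allFin d))

sumFin-zero : ∀ {d} {f : Fin d → ℕ} → (∀ i → f i ≡ 0) → sumFin f ≡ 0
sumFin-zero {d} f≡0 = sum-map-zero f≡0 (allFin d)

sumFin-suc : ∀ {d} (f : Fin (suc d) → ℕ) → sumFin f ≡ f zero + sumFin (f ∘ suc)
sumFin-suc f = cong (λ xs → f zero + sum xs) (trans (map-tabulate suc f) (sym (map-tabulate id (f ∘ suc))))

sum-allVertices-suc : ∀ {d} (f : Vertex (suc d) → ℕ) →
  sum (map f (allVertices (suc d))) ≡
  sum (map (f ∘ (false ∷_)) (allVertices d)) + sum (map (f ∘ (true ∷_)) (allVertices d))
sum-allVertices-suc {d} f = begin
  sum (map f (map (false ∷_) vs ++ map (true ∷_) vs))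
    ≡⟨ cong sum (map-++ f (map (false ∷_) vs) _) ⟩
  sum (map f (map (false ∷_) vs) ++ map f (map (true ∷_) vs))
    ≡⟨ sum-++ (map f (map (false ∷_) vs)) _ ⟩
  sum (map f (map (false ∷_) vs)) + sum (map f (map (true ∷_) vs))
    ≡⟨ cong₂ _+_ (cong sum (map-∘ vs)) (cong sum (map-∘ vs)) ⟨
  sum (map (f ∘ (false ∷_)) vs) + sum (map (f ∘ (true ∷_)) vs) ∎
  where
  open ≡-Reasoning
  vs = allVertices d

flip-involutive : ∀ {d} (x : Vertex d) i → flip (flip x i) i ≡ x
flip-involutive (true  ∷ x) zero    = refl
flip-involutive (false ∷ x) zero    = refl
flip-involutive (b     ∷ x) (suc i) = cong (b ∷_) (flip-involutive x i)

module _ {d : ℕ} where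

  infixr 7 _∩_
  infixr 6 _∪_ _∖_ _△_

  _∩_ _∪_ _∖_ _△_ : VSubset d → VSubset d → VSubset d
  (P ∩ Q) x = P x ∧ Q x
  (P ∪ Q) x = P x ∨ Q x
  (P ∖ Q) x = P x ∧ not (Q x)
  (P △ Q) x = P x xor Q x

  count : VSubset d → ℕ
  count P = sum (map (indicator ∘ P) (allVertices d))

  _≤ᵛ_ : Vertex d → Vertex d → Set
  _≤ᵛ_ = Pointwise _≤ᵇ_

  UpClosed : VSubset d → Set
  UpClosed U = ∀ {x y} → x ≤ᵛ y → U x ≡ true → U y ≡ true

  ∩-upClosed : ∀ {U₀ U₁} → UpClosed U₀ → UpClosed U₁ → UpClosed (U₀ ∩ U₁)
  ∩-upClosed {U₀} {U₁} up₀ up₁ {x} x≤y x∈U =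
    cong₂ _∧_ (up₀ x≤y (∧-conicalˡ (U₀ x) (U₁ x) x∈U)) (up₁ x≤y (∧-conicalʳ (U₀ x) (U₁ x) x∈U))

  ∪-upClosed : ∀ {U₀ U₁} → UpClosed U₀ → UpClosed U₁ → UpClosed (U₀ ∪ U₁)
  ∪-upClosed {U₀} {U₁} up₀ up₁ {x} {y} x≤y x∈U with U₀ x in x∈U₀
  ... | true  = cong (_∨ U₁ y) (up₀ x≤y x∈U₀)
  ... | false = trans (cong (U₀ y ∨_) (up₁ x≤y x∈U)) (∨-zeroʳ (U₀ y))

slice : ∀ {d} → Bool → VSubset (suc d) → VSubset d
slice b P z = P (b ∷ z)

glue : ∀ {d} → VSubset d → VSubset d → VSubset (suc d)
glue P Q (false ∷ z) = P z
glue P Q (true  ∷ z) = Q z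

count-suc : ∀ {d} (P : VSubset (suc d)) → count P ≡ count (slice false P) + count (slice true P)
count-suc P = sum-allVertices-suc (indicator ∘ P)

glue-upClosed : ∀ {d} {U₀ U₁ : VSubset d} → UpClosed U₀ → UpClosed U₁ →
  (∀ {z} → U₀ z ≡ true → U₁ z ≡ true) → UpClosed (glue U₀ U₁)
glue-upClosed up₀ up₁ U₀⊆U₁ (b≤b {false} ∷ x≤y) = up₀ x≤y
glue-upClosed up₀ up₁ U₀⊆U₁ (b≤b {true}  ∷ x≤y) = up₁ x≤y
glue-upClosed up₀ up₁ U₀⊆U₁ (f≤t         ∷ x≤y) = U₀⊆U₁ ∘ up₀ x≤y

tailsWith : ∀ {d} → Bool → List (Vertex (suc d)) → List (Vertex d)
tailsWith b []             = []
tailsWith b ((c ∷ v) ∷ xs) with c ≟ b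
... | yes _ = v ∷ tailsWith b xs
... | no  _ = tailsWith b xs

length-tailsWith : ∀ {d} (xs : List (Vertex (suc d))) →
  length xs ≡ length (tailsWith false xs) + length (tailsWith true xs)
length-tailsWith []                 = refl
length-tailsWith ((false ∷ v) ∷ xs) = cong suc (length-tailsWith xs)
length-tailsWith ((true  ∷ v) ∷ xs) = trans (cong suc (length-tailsWith xs)) (sym (+-suc _ _))

All-tailsWith : ∀ {d} {P : Vertex (suc d) → Set} b {xs} → All P xs → All (P ∘ (b ∷_)) (tailsWith b xs)
All-tailsWith b {[]}           []       = []
All-tailsWith b {(c ∷ v) ∷ xs} (p ∷ ps) with c ≟ b
... | yes refl = p ∷ All-tailsWith b ps
... | no  _    = All-tailsWith b ps

Unique-tailsWith : ∀ {d} b {xs : List (Vertex (suc d))} → Unique xs → Unique (tailsWith b xs)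
Unique-tailsWith b {[]}           []         = []
Unique-tailsWith b {(c ∷ v) ∷ xs} (v∉ ∷ uxs) with c ≟ b
... | yes refl = All.map (λ ne → ne ∘ cong (b ∷_)) (All-tailsWith b v∉) ∷ Unique-tailsWith b uxs
... | no  _    = Unique-tailsWith b uxs

unique-length≤count : ∀ {d} {P : VSubset d} {xs} → Unique xs → All (λ x → P x ≡ true) xs → length xs ≤ count P
unique-length≤count {zero}  {xs = []}                []              _           = z≤n
unique-length≤count {zero}  {xs = [] ∷ []}           _               (P[] ∷ []) =
  ≤-reflexive (cong (λ b → indicator b + 0) (sym P[]))
unique-length≤count {zero}  {xs = [] ∷ [] ∷ _}       ((ne ∷ _) ∷ _)  _           = ⊥-elim (ne refl)
unique-length≤count {suc d} {P} {xs} uxs xs⊆P = begin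
  length xs                                             ≡⟨ length-tailsWith xs ⟩
  length (tailsWith false xs) + length (tailsWith true xs)
    ≤⟨ +-mono-≤ (unique-length≤count (Unique-tailsWith false uxs) (All-tailsWith false xs⊆P))
                (unique-length≤count (Unique-tailsWith true uxs) (All-tailsWith true xs⊆P)) ⟩
  count (slice false P) + count (slice true P)          ≡⟨ count-suc P ⟨
  count P                                               ∎
  where open ≤-Reasoning

module _ {d : ℕ} (S U : VSubset d) (U-up : UpClosed U) where

  Violating : Vertex d × Vertex d → Set
  Violating p = S (proj₁ p) ≡ true × S (proj₂ p) ≡ false × proj₁ p ≤ᵛ proj₂ p

  witness : Vertex d × Vertex d → Vertex d
  witness (s , t) = if U s then t else s

  witness∈S△U : ∀ {p} → Violating p → (S △ U) (witness p) ≡ true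
  witness∈S△U {s , t} (s∈S , t∉S , s≤t) with U s in s∈U
  ... | true  rewrite t∉S = U-up s≤t s∈U
  ... | false rewrite s∈S | s∈U = refl

  private
    ∉≢∈ : ∀ {x y} → S x ≡ false → S y ≡ true → x ≢ y
    ∉≢∈ x∉S y∈S refl with trans (sym x∉S) y∈S
    ... | ()

  witness-injective : ∀ {p q} → Violating p → Violating q →
    proj₁ p ≢ proj₁ q × proj₂ p ≢ proj₂ q → witness p ≢ witness q
  witness-injective {s , t} {s′ , t′} (s∈S , t∉S , _) (s′∈S , t′∉S , _) (s≢s′ , t≢t′) with U s | U s′
  ... | true  | true  = t≢t′
  ... | false | false = s≢s′
  ... | true  | false = ∉≢∈ t∉S s′∈S
  ... | false | true  = ≢-sym (∉≢∈ t′∉S s∈S)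

  matchedPair-size≤count△ : (M : MatchedPairIn S) → MatchedPairIn.size M ≤ count (S △ U)
  matchedPair-size≤count△ M = begin
    length pairs               ≡⟨ length-map witness pairs ⟨
    length (map witness pairs) ≤⟨ unique-length≤count witnesses-unique (All.map⁺ (All.map witness∈S△U violating)) ⟩
    count (S △ U)              ∎
    where
    open MatchedPairIn M
    open ≤-Reasoning
    violating : All Violating pairs
    violating = All.zip (srcInS , All.zip (tgtNotInS , All.map (extensional⇒inductive ∘ ext ∘ proj₂) below))
    witnesses-unique : Unique (map witness pairs)
    witnesses-unique = AllPairs.map⁺ (AllPairs-mapWithAll witness-injective violating
      (AllPairs.zip (AllPairs.map⁻ srcUnique , AllPairs.map⁻ tgtUnique)))

module _ {d : ℕ} (S : VSubset d) where

  isBoundaryEdge : Vertex d → Fin d → Bool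
  isBoundaryEdge x i = not (lookup x i) ∧ S x ∧ not (S (flip x i))

  boundaryOutDegree boundaryInDegree : Vertex d → ℕ
  boundaryOutDegree x = sumFin (λ i → indicator (isBoundaryEdge x i))
  boundaryInDegree  x = sumFin (λ i → if lookup x i then indicator (isBoundaryEdge (flip x i) i) else 0)

  boundarySize : ℕ
  boundarySize = sum (map boundaryOutDegree (allVertices d))

  private
    isBoundaryEdge-from-1 : ∀ x i → lookup x i ≡ true → isBoundaryEdge x i ≡ false
    isBoundaryEdge-from-1 x i xᵢ≡1 rewrite xᵢ≡1 = refl

    isBoundaryEdge-from-S̄ : ∀ {x} i → S x ≡ false → isBoundaryEdge x i ≡ false
    isBoundaryEdge-from-S̄ {x} i x∉S rewrite x∉S = ∧-zeroʳ (not (lookup x i))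

    isBoundaryEdge-into-S : ∀ {x} i → S x ≡ true → isBoundaryEdge (flip x i) i ≡ false
    isBoundaryEdge-into-S {x} i x∈S rewrite flip-involutive x i | x∈S =
      trans (cong (not (lookup (flip x i) i) ∧_) (∧-zeroʳ (S (flip x i)))) (∧-zeroʳ _)

    boundaryInDegree-∈S : ∀ {x} → S x ≡ true → boundaryInDegree x ≡ 0
    boundaryInDegree-∈S {x} x∈S =
      sumFin-zero (λ i → if-then-0 (lookup x i) (cong indicator (isBoundaryEdge-into-S i x∈S)))

    outflow≡boundaryOutDegree : ∀ x →
      sumFin (λ i → if lookup x i then 0 else indicator (isBoundaryEdge x i)) ≡ boundaryOutDegree x
    outflow≡boundaryOutDegree x =
      sumFin-cong (λ i → if-then-0-else (lookup x i) (cong indicator ∘ isBoundaryEdge-from-1 x i))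

  boundaryFlow : Flow S
  boundaryFlow = record
    { hyp          = λ x i → indicator (isBoundaryEdge x i)
    ; src          = boundaryOutDegree
    ; snk          = boundaryInDegree
    ; capacity     = λ x i → indicator≤1 (isBoundaryEdge x i)
    ; noEdge       = λ x i → cong indicator ∘ isBoundaryEdge-from-1 x i
    ; srcOnlyS     = λ x x∉S → sumFin-zero (λ i → cong indicator (isBoundaryEdge-from-S̄ i x∉S))
    ; snkOnlyS̄     = λ x → boundaryInDegree-∈S
    ; conservation = λ x → trans (+-comm (boundaryOutDegree x) (boundaryInDegree x))
                                 (cong (boundaryInDegree x +_) (sym (outflow≡boundaryOutDegree x)))
    }

boundarySize-suc : ∀ {d} (S : VSubset (suc d)) →
  boundarySize S ≡ count (slice false S ∖ slice true S) + boundarySize (slice false S) + boundarySize (slice true S)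
boundarySize-suc {d} S = begin
  boundarySize S
    ≡⟨ sum-allVertices-suc (boundaryOutDegree S) ⟩
  sum (map (boundaryOutDegree S ∘ (false ∷_)) vs) + sum (map (boundaryOutDegree S ∘ (true ∷_)) vs)
    ≡⟨ cong₂ _+_ (cong sum (map-cong (sumFin-suc ∘ boundaryEdges ∘ (false ∷_)) vs))
                 (cong sum (map-cong (sumFin-suc ∘ boundaryEdges ∘ (true ∷_)) vs)) ⟩
  sum (map (λ z → indicator ((S₀ ∖ S₁) z) + boundaryOutDegree S₀ z) vs) + boundarySize S₁
    ≡⟨ cong (_+ boundarySize S₁) (sum-map-+ (indicator ∘ (S₀ ∖ S₁)) (boundaryOutDegree S₀) vs) ⟩
  count (S₀ ∖ S₁) + boundarySize S₀ + boundarySize S₁ ∎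
  where
  open ≡-Reasoning
  vs = allVertices d
  S₀ S₁ : VSubset d
  S₀ = slice false S
  S₁ = slice true S
  boundaryEdges : Vertex (suc d) → Fin (suc d) → ℕ
  boundaryEdges x i = indicator (isBoundaryEdge S x i)

-- Unless p = true and q = false, the pair (p ∧ q , p ∨ q) is just (p , q).
indicator-exchange : ∀ a b p q →
  indicator (a xor (p ∧ q)) + indicator (b xor (p ∨ q)) ≤
  (indicator (a xor p) + indicator (b xor q)) + (indicator (a ∧ not b) + indicator (a ∧ not b))
indicator-exchange a     b     false false = m≤m+n _ _
indicator-exchange a     b     false true  = m≤m+n _ _
indicator-exchange a     b     true  true  = m≤m+n _ _
indicator-exchange false false true  false = ≤ᵇ⇒≤ _ _ tt
indicator-exchange false true  true  false = ≤ᵇ⇒≤ _ _ tt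
indicator-exchange true  false true  false = ≤ᵇ⇒≤ _ _ tt
indicator-exchange true  true  true  false = ≤ᵇ⇒≤ _ _ tt

count+count : ∀ {d} (P Q : VSubset d) →
  count P + count Q ≡ sum (map (λ x → indicator (P x) + indicator (Q x)) (allVertices d))
count+count {d} P Q = sym (sum-map-+ (indicator ∘ P) (indicator ∘ Q) (allVertices d))

count-exchange : ∀ {d} (S₀ S₁ U₀ U₁ : VSubset d) →
  count (S₀ △ U₀ ∩ U₁) + count (S₁ △ U₀ ∪ U₁) ≤
  (count (S₀ △ U₀) + count (S₁ △ U₁)) + (count (S₀ ∖ S₁) + count (S₀ ∖ S₁))
count-exchange {d} S₀ S₁ U₀ U₁ = begin
  count (S₀ △ U₀ ∩ U₁) + count (S₁ △ U₀ ∪ U₁)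
    ≡⟨ count+count (S₀ △ U₀ ∩ U₁) (S₁ △ U₀ ∪ U₁) ⟩
  sum (map (λ z → indicator ((S₀ △ U₀ ∩ U₁) z) + indicator ((S₁ △ U₀ ∪ U₁) z)) vs)
    ≤⟨ sum-map-mono (λ z → indicator-exchange (S₀ z) (S₁ z) (U₀ z) (U₁ z)) vs ⟩
  sum (map (λ z → d△ z + c△ z) vs)
    ≡⟨ sum-map-+ d△ c△ vs ⟩
  sum (map d△ vs) + sum (map c△ vs)
    ≡⟨ cong₂ _+_ (count+count (S₀ △ U₀) (S₁ △ U₁)) (count+count (S₀ ∖ S₁) (S₀ ∖ S₁)) ⟨
  (count (S₀ △ U₀) + count (S₁ △ U₁)) + (count (S₀ ∖ S₁) + count (S₀ ∖ S₁)) ∎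
  where
  open ≤-Reasoning
  vs = allVertices d
  d△ c△ : Vertex d → ℕ
  d△ z = indicator ((S₀ △ U₀) z) + indicator ((S₁ △ U₁) z)
  c△ z = indicator ((S₀ ∖ S₁) z) + indicator ((S₀ ∖ S₁) z)

module _ {d} (S : VSubset (suc d)) {U₀ U₁ : VSubset d} (up₀ : UpClosed U₀) (up₁ : UpClosed U₁) where

  private
    S₀ S₁ : VSubset d
    S₀ = slice false S
    S₁ = slice true S

    V W : VSubset (suc d)
    V = glue (U₀ ∩ U₁) U₁
    W = glue U₀ (U₀ ∪ U₁)

    D₀ D₁ c : ℕ
    D₀ = count (S₀ △ U₀)
    D₁ = count (S₁ △ U₁)
    c  = count (S₀ ∖ S₁)

    rearrange₁ : ∀ x y d₀ d₁ → (x + d₁) + (d₀ + y) ≡ (x + y) + (d₀ + d₁)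
    rearrange₁ = solve-∀

    rearrange₂ : ∀ c d₀ d₁ → ((d₀ + d₁) + (c + c)) + (d₀ + d₁) ≡ (c + d₀ + d₁) + (c + d₀ + d₁)
    rearrange₂ = solve-∀

    count△V+count△W≤ : count (S △ V) + count (S △ W) ≤ (c + D₀ + D₁) + (c + D₀ + D₁)
    count△V+count△W≤ = begin
      count (S △ V) + count (S △ W)
        ≡⟨ cong₂ _+_ (count-suc (S △ V)) (count-suc (S △ W)) ⟩
      (count (S₀ △ U₀ ∩ U₁) + D₁) + (D₀ + count (S₁ △ U₀ ∪ U₁))
        ≡⟨ rearrange₁ (count (S₀ △ U₀ ∩ U₁)) (count (S₁ △ U₀ ∪ U₁)) D₀ D₁ ⟩
      (count (S₀ △ U₀ ∩ U₁) + count (S₁ △ U₀ ∪ U₁)) + (D₀ + D₁)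
        ≤⟨ +-monoˡ-≤ (D₀ + D₁) (count-exchange S₀ S₁ U₀ U₁) ⟩
      ((D₀ + D₁) + (c + c)) + (D₀ + D₁)
        ≡⟨ rearrange₂ c D₀ D₁ ⟩
      (c + D₀ + D₁) + (c + D₀ + D₁) ∎
      where open ≤-Reasoning

  upClosed-from-slices : Σ (VSubset (suc d)) λ U → UpClosed U ×
    count (S △ U) ≤ count (slice false S ∖ slice true S) + count (slice false S △ U₀) + count (slice true S △ U₁)
  upClosed-from-slices with m+n≤o+o⇒m≤o⊎n≤o count△V+count△W≤
  ... | inj₁ V≤ = V , glue-upClosed (∩-upClosed up₀ up₁) up₁ (λ {z} → ∧-conicalʳ (U₀ z) (U₁ z)) , V≤
  ... | inj₂ W≤ = W , glue-upClosed up₀ (∪-upClosed up₀ up₁) (λ {z} → cong (_∨ U₁ z)) , W≤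

upClosed-within-boundary : ∀ {d} (S : VSubset d) → Σ (VSubset d) λ U → UpClosed U × count (S △ U) ≤ boundarySize S
upClosed-within-boundary {zero} S =
  S , (λ { [] → id }) , ≤-reflexive (cong (λ b → indicator b + 0) (xor-same (S [])))
upClosed-within-boundary {suc d} S =
  let U₀ , up₀ , S₀△U₀≤∂S₀ = upClosed-within-boundary (slice false S)
      U₁ , up₁ , S₁△U₁≤∂S₁ = upClosed-within-boundary (slice true S)
      U  , up  , S△U≤      = upClosed-from-slices S up₀ up₁
  in U , up , ≤-trans S△U≤
       (≤-trans (+-mono-≤ (+-monoʳ-≤ _ S₀△U₀≤∂S₀) S₁△U₁≤∂S₁) (≤-reflexive (sym (boundarySize-suc S))))

theorem4p6 : (d : ℕ) → 1 ≤ d → (S : VSubset d) → (M : MatchedPairIn S) →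
    Σ (Flow S) (λ F → MatchedPairIn.size M ≤ Flow.value F)
theorem4p6 d _ S M =
  let U , U-up , S△U≤∂S = upClosed-within-boundary S
  in boundaryFlow S , ≤-trans (matchedPair-size≤count△ S U U-up M) S△U≤∂S
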